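{- Let $\mathcal{F}$ be the total primitive term specification for $\mathsf{QLP}^-$. If $A$ is an axiom instance of $\mathsf{QLP}^-$ and $x$ is a justification variable not occurring free in $A$, then $\mathsf{QLP}^-_{\mathcal{F}}\vdash(\exists x)x:A$; i.e. the rule "from an axiom instance $A$ infer $(\exists x)x:A$ (with $x$ not free in $A$)" is admissible in $\mathsf{QLP}^-_{\mathcal{F}}$.
   Context: Fix countably many justification variables, propositional variables, and primitive function symbols of each arity $n\ge0$ (arity $0$: constants). A primitive term is $f(x_1,\dots,x_n)$ with $f$ of arity $n$ and $x_i$ variables. Terms of $\mathsf{QLP}^-$: $t::= x\mid f(x_1,\dots,x_n)\mid t\cdot t\mid t+t\mid !t$. Formulas: $A::= p\mid\bot\mid\neg A\mid A\wedge A\mid A\vee A\mid A\rightarrow A\mid t:A\mid(\forall x)A\mid(\exists x)A$, with $x$ a justification variable; free/bound variables and substitution as in first-order logic. Axioms: all propositional tautologies; Q1: $(\forall x)A(x)\rightarrow A(t)$, $t$ free for $x$; Q2: $(\forall x)(A\rightarrow B(x))\rightarrow(A\rightarrow(\forall x)B(x))$, $x$ not free in $A$; Q3: $A(t)\rightarrow(\exists x)A(x)$, $t$ free for $x$; Q4: $(\forall x)(A(x)\rightarrow B)\rightarrow((\exists x)A(x)\rightarrow B)$, $x$ not free in $B$; jK: $s:(A\rightarrow B)\rightarrow(t:A\rightarrow(s\cdot t):B)$; jT: $t:A\rightarrow A$; j4: $t:A\rightarrow !t:t:A$; Sum: $s:A\rightarrow(s+t):A$, $s:A\rightarrow(t+s):A$.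 Rules: Modus Ponens; Gen: from $A$ infer $(\forall x)A$; Axiom Necessitation (AN): from an axiom instance $A$ infer $f(x_1,\dots,x_n):A$ for a primitive term. The total primitive term specification is the set of all $f(x_1,\dots,x_n):A$ with $A$ an axiom instance and $f(x_1,\dots,x_n)$ a primitive term; for a primitive term specification $\mathcal{F}$ (a subset of it), $\mathsf{QLP}^-_{\mathcal{F}}$ is the logic in which AN only produces members of $\mathcal{F}$. -}

module Defs where

open import Data.Nat using (ℕ; _≟_)
open import Data.Bool using (Bool; true; false; _∧_; _∨_; not; if_then_else_)
open import Data.Vec using (Vec; []; _∷_)
open import Data.Product using (_×_)
open import Relation.Nullary.Decidable using (⌊_⌋)
open import Relation.Binary.PropositionalEquality using (_≡_)

JVar : Set
JVar = ℕ

infixl 7 _·_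
infixl 6 _⊕_

data Term : Set where
  var  : JVar → Term
  prim : (n f : ℕ) → Vec JVar n → Term   -- f-th function symbol of arity n applied to variables
  _·_  : Term → Term → Term
  _⊕_  : Term → Term → Term
  !_   : Term → Term

infixr 5 _⇒_
infixr 6 _∨'_
infixr 7 _∧'_
infix 8 _∶_

data Formula : Set where
  patom : ℕ → Formula
  ⊥'    : Formula
  ¬'_   : Formula → Formula
  _∧'_  : Formula → Formula → Formula
  _∨'_  : Formula → Formula → Formula
  _⇒_   : Formula → Formula → Formula
  _∶_   : Term → Formula → Formula
  all'  : JVar → Formula → Formula
  ex'   : JVar → Formula → Formula

eqv : ℕ → ℕ → Bool
eqv x y = ⌊ x ≟ y ⌋

occVec : ∀ {n} → JVar → Vec JVar n → Bool
occVec x []       = false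
occVec x (y ∷ ys) = eqv x y ∨ occVec x ys

occT : JVar → Term → Bool
occT x (var y)       = eqv x y
occT x (prim n f ys) = occVec x ys
occT x (s · t)       = occT x s ∨ occT x t
occT x (s ⊕ t)       = occT x s ∨ occT x t
occT x (! t)         = occT x t

free : JVar → Formula → Bool
free x (patom p) = false
free x ⊥'        = false
free x (¬' A)    = free x A
free x (A ∧' B)  = free x A ∨ free x B
free x (A ∨' B)  = free x A ∨ free x B
free x (A ⇒ B)   = free x A ∨ free x B
free x (t ∶ A)   = occT x t ∨ free x A
free x (all' y A) = not (eqv x y) ∧ free x A
free x (ex' y A)  = not (eqv x y) ∧ free x A

-- In a primitive term f(x₁,…,xₙ) the arguments must stay variables, so
-- substituting t for x inside a primitive term yields a term of the
-- language only when t is a variable (a renaming).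
substVecVar : ∀ {n} → JVar → JVar → Vec JVar n → Vec JVar n
substVecVar z x []       = []
substVecVar z x (y ∷ ys) = (if eqv x y then z else y) ∷ substVecVar z x ys

substT : Term → JVar → Term → Term
substT t x (var y)       = if eqv x y then t else var y
substT (var z) x (prim n f ys) = prim n f (substVecVar z x ys)
substT t x (prim n f ys) = prim n f ys
substT t x (s · u)       = substT t x s · substT t x u
substT t x (s ⊕ u)       = substT t x s ⊕ substT t x u
substT t x (! u)         = ! substT t x u

subst : Term → JVar → Formula → Formula
subst t x (patom p)  = patom p
subst t x ⊥'         = ⊥'
subst t x (¬' A)     = ¬' subst t x A
subst t x (A ∧' B)   = subst t x A ∧' subst t x B
subst t x (A ∨' B)   = subst t x A ∨' subst t x B
subst t x (A ⇒ B)    = subst t x A ⇒ subst t x B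
subst t x (u ∶ A)    = substT t x u ∶ subst t x A
subst t x (all' y A) = if eqv x y then all' y A else all' y (subst t x A)
subst t x (ex' y A)  = if eqv x y then ex' y A else ex' y (subst t x A)

-- substituting t for x in u yields a genuine term: if t is not a
-- variable, x must not occur as an argument of a primitive term in u
isVar : Term → Bool
isVar (var _) = true
isVar _       = false

substOKT : Term → JVar → Term → Bool
substOKT t x (var y)       = true
substOKT t x (prim n f ys) = isVar t ∨ not (occVec x ys)
substOKT t x (s · u)       = substOKT t x s ∧ substOKT t x u
substOKT t x (s ⊕ u)       = substOKT t x s ∧ substOKT t x u
substOKT t x (! u)         = substOKT t x u

freeFor : Term → JVar → Formula → Bool
freeFor t x (patom p)  = true
freeFor t x ⊥'         = true
freeFor t x (¬' A)     = freeFor t x A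
freeFor t x (A ∧' B)   = freeFor t x A ∧ freeFor t x B
freeFor t x (A ∨' B)   = freeFor t x A ∧ freeFor t x B
freeFor t x (A ⇒ B)    = freeFor t x A ∧ freeFor t x B
freeFor t x (u ∶ A)    = substOKT t x u ∧ freeFor t x A
freeFor t x (all' y A) = not (free x (all' y A)) ∨ (not (occT y t) ∧ freeFor t x A)
freeFor t x (ex' y A)  = not (free x (ex' y A)) ∨ (not (occT y t) ∧ freeFor t x A)

-- Propositional tautologies: formulas true under every Boolean
-- assignment to their propositionally atomic subformulas
-- (p, t:A, (∀x)A, (∃x)A).

evalP : (Formula → Bool) → Formula → Bool
evalP v (patom p)  = v (patom p)
evalP v ⊥'         = false
evalP v (¬' A)     = not (evalP v A)
evalP v (A ∧' B)   = evalP v A ∧ evalP v B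
evalP v (A ∨' B)   = evalP v A ∨ evalP v B
evalP v (A ⇒ B)    = not (evalP v A) ∨ evalP v B
evalP v (t ∶ A)    = v (t ∶ A)
evalP v (all' x A) = v (all' x A)
evalP v (ex' x A)  = v (ex' x A)

Tautology : Formula → Set
Tautology A = (v : Formula → Bool) → evalP v A ≡ true

data Axiom : Formula → Set where
  taut : ∀ {A} → Tautology A → Axiom A
  Q1   : ∀ x A t → freeFor t x A ≡ true → Axiom (all' x A ⇒ subst t x A)
  Q2   : ∀ x A B → free x A ≡ false → Axiom (all' x (A ⇒ B) ⇒ (A ⇒ all' x B))
  Q3   : ∀ x A t → freeFor t x A ≡ true → Axiom (subst t x A ⇒ ex' x A)
  Q4   : ∀ x A B → free x B ≡ false → Axiom (all' x (A ⇒ B) ⇒ (ex' x A ⇒ B))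
  jK   : ∀ s t A B → Axiom (s ∶ (A ⇒ B) ⇒ (t ∶ A ⇒ (s · t) ∶ B))
  jT   : ∀ t A → Axiom (t ∶ A ⇒ A)
  j4   : ∀ t A → Axiom (t ∶ A ⇒ (! t) ∶ (t ∶ A))
  sumL : ∀ s t A → Axiom (s ∶ A ⇒ (s ⊕ t) ∶ A)
  sumR : ∀ s t A → Axiom (s ∶ A ⇒ (t ⊕ s) ∶ A)

-- A primitive term specification: a set of formulas f(x₁,…,xₙ):A
-- (presented by its primitive term and A), contained in the total one.
PrimSpec : Set₁
PrimSpec = (n f : ℕ) → Vec JVar n → Formula → Set

TotalSpec : PrimSpec
TotalSpec n f xs A = Axiom A

data _⊢_ (𝓕 : PrimSpec) : Formula → Set where
  ax  : ∀ {A} → Axiom A → 𝓕 ⊢ A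
  mp  : ∀ {A B} → 𝓕 ⊢ (A ⇒ B) → 𝓕 ⊢ A → 𝓕 ⊢ B
  gen : ∀ {A} x → 𝓕 ⊢ A → 𝓕 ⊢ all' x A
  an  : ∀ {A} n f (xs : Vec JVar n) → Axiom A → 𝓕 n f xs A → 𝓕 ⊢ (prim n f xs ∶ A)

module Submission where

-- A constant c (a primitive function symbol of arity 0) is a
-- primitive term, so Axiom Necessitation under the total specification
-- yields  c : A  for every axiom instance A.  The axiom Q3 with term t
-- reads  (x:A)[t/x] → (∃x) x:A ; when x is not free in A the
-- antecedent is literally  t : A , and t is automatically free for x.
-- Hence the theorem follows by one modus ponens.

open import Defs
open import Data.Bool using (true; false; _∧_; _∨_)
open import Data.Bool.Properties using (∨-zeroʳ)
open import Data.Nat using (_≟_)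
open import Data.Product using (_×_; _,_)
open import Data.Vec using (Vec; []; _∷_)
open import Relation.Nullary using (yes; no; contradiction)
open import Relation.Binary.PropositionalEquality
  using (_≡_; refl; cong; cong₂)
  renaming (subst to transport)

∨-false : ∀ a {b} → a ∨ b ≡ false → (a ≡ false) × (b ≡ false)
∨-false false b≡false = refl , b≡false

∧-true : ∀ {a b} → a ≡ true → b ≡ true → a ∧ b ≡ true
∧-true refl refl = refl

eqv-refl : ∀ x → eqv x x ≡ true
eqv-refl x with x ≟ x
... | yes _   = refl
... | no x≢x = contradiction refl x≢x

substVecVar-fresh : ∀ {n} z x (ys : Vec JVar n) →
  occVec x ys ≡ false → substVecVar z x ys ≡ ys
substVecVar-fresh z x []       _ = refl
substVecVar-fresh z x (y ∷ ys) x∉ with eqv x y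
... | false = cong (y ∷_) (substVecVar-fresh z x ys x∉)

substT-fresh : ∀ t x u → occT x u ≡ false → substT t x u ≡ u
substT-fresh t x (var y) x∉ rewrite x∉ = refl
substT-fresh (var z) x (prim n f ys) x∉ =
  cong (prim n f) (substVecVar-fresh z x ys x∉)
substT-fresh (prim _ _ _) x (prim n f ys) x∉ = refl
substT-fresh (_ · _) x (prim n f ys) x∉ = refl
substT-fresh (_ ⊕ _) x (prim n f ys) x∉ = refl
substT-fresh (! _) x (prim n f ys) x∉ = refl
substT-fresh t x (s · u) x∉ with ∨-false (occT x s) x∉
... | x∉s , x∉u = cong₂ _·_ (substT-fresh t x s x∉s) (substT-fresh t x u x∉u)
substT-fresh t x (s ⊕ u) x∉ with ∨-false (occT x s) x∉
... | x∉s , x∉u = cong₂ _⊕_ (substT-fresh t x s x∉s) (substT-fresh t x u x∉u)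
substT-fresh t x (! u) x∉ = cong !_ (substT-fresh t x u x∉)

subst-fresh : ∀ t x A → free x A ≡ false → subst t x A ≡ A
subst-fresh t x (patom p) _ = refl
subst-fresh t x ⊥' _ = refl
subst-fresh t x (¬' A) x∉ = cong ¬'_ (subst-fresh t x A x∉)
subst-fresh t x (A ∧' B) x∉ with ∨-false (free x A) x∉
... | x∉A , x∉B = cong₂ _∧'_ (subst-fresh t x A x∉A) (subst-fresh t x B x∉B)
subst-fresh t x (A ∨' B) x∉ with ∨-false (free x A) x∉
... | x∉A , x∉B = cong₂ _∨'_ (subst-fresh t x A x∉A) (subst-fresh t x B x∉B)
subst-fresh t x (A ⇒ B) x∉ with ∨-false (free x A) x∉
... | x∉A , x∉B = cong₂ _⇒_ (subst-fresh t x A x∉A) (subst-fresh t x B x∉B)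
subst-fresh t x (u ∶ A) x∉ with ∨-false (occT x u) x∉
... | x∉u , x∉A = cong₂ _∶_ (substT-fresh t x u x∉u) (subst-fresh t x A x∉A)
subst-fresh t x (all' y A) x∉ with eqv x y
... | true  = refl
... | false = cong (all' y) (subst-fresh t x A x∉)
subst-fresh t x (ex' y A) x∉ with eqv x y
... | true  = refl
... | false = cong (ex' y) (subst-fresh t x A x∉)

substOKT-fresh : ∀ t x u → occT x u ≡ false → substOKT t x u ≡ true
substOKT-fresh t x (var y) _ = refl
substOKT-fresh t x (prim n f ys) x∉ rewrite x∉ = ∨-zeroʳ (isVar t)
substOKT-fresh t x (s · u) x∉ with ∨-false (occT x s) x∉
... | x∉s , x∉u = ∧-true (substOKT-fresh t x s x∉s) (substOKT-fresh t x u x∉u)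
substOKT-fresh t x (s ⊕ u) x∉ with ∨-false (occT x s) x∉
... | x∉s , x∉u = ∧-true (substOKT-fresh t x s x∉s) (substOKT-fresh t x u x∉u)
substOKT-fresh t x (! u) x∉ = substOKT-fresh t x u x∉

freeFor-fresh : ∀ t x A → free x A ≡ false → freeFor t x A ≡ true
freeFor-fresh t x (patom p) _ = refl
freeFor-fresh t x ⊥' _ = refl
freeFor-fresh t x (¬' A) x∉ = freeFor-fresh t x A x∉
freeFor-fresh t x (A ∧' B) x∉ with ∨-false (free x A) x∉
... | x∉A , x∉B = ∧-true (freeFor-fresh t x A x∉A) (freeFor-fresh t x B x∉B)
freeFor-fresh t x (A ∨' B) x∉ with ∨-false (free x A) x∉
... | x∉A , x∉B = ∧-true (freeFor-fresh t x A x∉A) (freeFor-fresh t x B x∉B)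
freeFor-fresh t x (A ⇒ B) x∉ with ∨-false (free x A) x∉
... | x∉A , x∉B = ∧-true (freeFor-fresh t x A x∉A) (freeFor-fresh t x B x∉B)
freeFor-fresh t x (u ∶ A) x∉ with ∨-false (occT x u) x∉
... | x∉u , x∉A = ∧-true (substOKT-fresh t x u x∉u) (freeFor-fresh t x A x∉A)
freeFor-fresh t x (all' y A) x∉ rewrite x∉ = refl
freeFor-fresh t x (ex' y A) x∉ rewrite x∉ = refl

subst-justification : ∀ t x A → free x A ≡ false →
  subst t x (var x ∶ A) ≡ (t ∶ A)
subst-justification t x A x∉ rewrite eqv-refl x | subst-fresh t x A x∉ = refl

∃-justification : ∀ {𝓕} t x A → free x A ≡ false →
  𝓕 ⊢ (t ∶ A) → 𝓕 ⊢ ex' x (var x ∶ A)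
∃-justification {𝓕} t x A x∉ ⊢t∶A = mp ⊢Q3 ⊢t∶A
  where
  t-free-for-x : freeFor t x (var x ∶ A) ≡ true
  t-free-for-x = freeFor-fresh t x A x∉

  ⊢Q3 : 𝓕 ⊢ (t ∶ A ⇒ ex' x (var x ∶ A))
  ⊢Q3 = transport (λ F → 𝓕 ⊢ (F ⇒ ex' x (var x ∶ A)))
          (subst-justification t x A x∉)
          (ax (Q3 x (var x ∶ A) t t-free-for-x))

constant : Term
constant = prim 0 0 []

theorem21 : (A : Formula) (x : JVar) → Axiom A → free x A ≡ false →
    TotalSpec ⊢ ex' x (var x ∶ A)
theorem21 A x axA x∉A = ∃-justification constant x A x∉A ⊢constant∶A
  where
  ⊢constant∶A : TotalSpec ⊢ (constant ∶ A)
  ⊢constant∶A = an 0 0 [] axA axA
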